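{- Let $p$ be an odd prime. For a positive integer $m$ and a sequence of variables $\mathbf{z}=(z_1,z_2,\dots)$ let $\mathfrak{I}_m(\mathbf{z})=\frac{1}{m}\sum_{r\mid m}\phi(r)\,z_r^{m/r}$ (the cycle index of the regular cyclic group of order $m$, $\phi$ Euler's function). Define $A_1(t)=\mathfrak{I}_{p-1}(\mathbf{x})\,\mathfrak{I}_{p-1}(\mathbf{y})$ and $A_{22}(t)=\mathfrak{I}_{p-1}(\mathbf{x}\mathbf{y})$, where $\mathbf{x}\mathbf{y}=(x_1y_1,x_2y_2,\dots)$, both evaluated at $x_r=1+t^r$, $y_r=1+t^{pr}$ for all $r\ge1$. Then $A_1(t)\equiv A_1(t^p)$ and $A_{22}(t)\equiv A_{22}(t^p)$ modulo the ideal of $\mathbb{Q}[t]$ generated by $t^{p^2-1}-1$.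
   Context: In the paper these polynomials $A_1(t)=A_1[d;p^2](t)$ and $A_{22}(t)=A_{22}[d;p^2](t)$ are valency-specified intermediate enumerators arising in the enumeration of directed circulant graphs of order $p^2$; for the statement they are defined by the explicit formulas given. -}

module Defs where

open import Data.Nat as ℕ using (ℕ; zero; suc; _∸_; NonZero)
open import Data.Nat.DivMod using (_/_)
open import Data.Nat.Divisibility using (_∣?_)
open import Data.Nat.Coprimality using (coprime?)
open import Data.Integer using (+_)
open import Data.Rational as ℚ using (ℚ; 0ℚ; 1ℚ; _+_; _*_; -_)
open import Data.List using (List; []; _∷_; map; filter; length; upTo; replicate; _++_; foldr)
open import Data.Product using (Σ)
open import Relation.Binary.PropositionalEquality using (_≡_)

-- Polynomials in ℚ[t] as coefficient lists (constant term first).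
Poly : Set
Poly = List ℚ

coeff : Poly → ℕ → ℚ
coeff []      _       = 0ℚ
coeff (a ∷ f) zero    = a
coeff (a ∷ f) (suc i) = coeff f i

infixl 6 _⊕_ _⊖_
infixl 7 _⊗_

_⊕_ : Poly → Poly → Poly
[]      ⊕ g       = g
(a ∷ f) ⊕ []      = a ∷ f
(a ∷ f) ⊕ (b ∷ g) = (a + b) ∷ (f ⊕ g)

scale : ℚ → Poly → Poly
scale c f = map (c *_) f

_⊖_ : Poly → Poly → Poly
f ⊖ g = f ⊕ scale (- 1ℚ) g

_⊗_ : Poly → Poly → Poly
[]      ⊗ g = []
(a ∷ f) ⊗ g = scale a g ⊕ (0ℚ ∷ (f ⊗ g))

const : ℚ → Poly
const c = c ∷ []

onePoly : Poly
onePoly = const 1ℚ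

pow : Poly → ℕ → Poly
pow f zero    = onePoly
pow f (suc n) = f ⊗ pow f n

tpow : ℕ → Poly
tpow k = replicate k 0ℚ ++ (1ℚ ∷ [])

-- composition f(g(t)) (Horner); f(t^p) is  compose f (tpow p)
compose : Poly → Poly → Poly
compose []      g = []
compose (c ∷ f) g = const c ⊕ (g ⊗ compose f g)

polySum : List Poly → Poly
polySum = foldr _⊕_ []

ℕ→ℚ : ℕ → ℚ
ℕ→ℚ n = + n ℚ./ 1

φ : ℕ → ℕ
φ r = length (filter (λ k → coprime? k r) (map suc (upTo r)))

-- Cycle index of the regular cyclic group of order m, evaluated at z:
--   I_m(z) = (1/m) Σ_{r ∣ m} φ(r) z_r^{m/r}
-- (divisors r = suc k with 0 ≤ k < m; m = 0 does not occur)
cycleIndex : ℕ → (ℕ → Poly) → Poly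
cycleIndex zero      z = []
cycleIndex m@(suc n) z =
  scale (+ 1 ℚ./ m)
    (polySum (map (λ k → scale (ℕ→ℚ (φ (suc k))) (pow (z (suc k)) (m / suc k)))
                  (filter (λ k → suc k ∣? m) (upTo m))))

xs : ℕ → ℕ → Poly
xs p r = onePoly ⊕ tpow r

ys : ℕ → ℕ → Poly
ys p r = onePoly ⊕ tpow (p ℕ.* r)

A₁ : ℕ → Poly
A₁ p = cycleIndex (p ∸ 1) (xs p) ⊗ cycleIndex (p ∸ 1) (ys p)

A₂₂ : ℕ → Poly
A₂₂ p = cycleIndex (p ∸ 1) (λ r → xs p r ⊗ ys p r)

-- f ≡ g modulo the ideal (h) of ℚ[t]:  f - g = q · h for some q ∈ ℚ[t]
-- (polynomial equality = equality of all coefficients)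
_≡_[mod_] : Poly → Poly → Poly → Set
f ≡ g [mod h ] = Σ Poly (λ q → ∀ i → coeff (f ⊖ g) i ≡ coeff (q ⊗ h) i)

-- Substitution f ↦ f(s) is a ring homomorphism of ℚ[t], so it
-- commutes with the cycle index: I_m(z)(s) = I_m(z(s)), where z(s) is z
-- with s substituted into every entry.  For s = t^p we have
-- x_r(t^p) = 1 + t^(pr) = y_r exactly, and y_r(t^p) = 1 + t^(p²r) ≡ x_r
-- because t^(p²) = t · t^(p²-1) ≡ t.  Hence substitution swaps the two
-- sequences x and y modulo the ideal, and any expression symmetric under
-- that swap — the product I_m(x) I_m(y) and I_m(xy) — is invariant.
module Submission where

open import Defs
open import Data.Nat using (ℕ; _*_; _∸_)
open import Data.Nat.Primality using (Prime)
open import Data.Product using (_×_)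
open import Relation.Binary.PropositionalEquality using (_≢_)

open import Data.Nat using (zero; suc; _+_)
import Data.Nat.Properties as ℕP
open import Data.Nat.DivMod using (_/_)
open import Data.Nat.Divisibility using (_∣?_)
open import Data.Nat.Primality using (prime)
import Data.Integer as ℤ
open import Data.Rational as Q using (ℚ; 0ℚ; 1ℚ)
import Data.Rational.Properties as QP
open import Data.Rational.Solver using (module +-*-Solver)
open +-*-Solver using (solve; _:+_; _:*_; _:=_; con)
open import Data.List using (List; []; _∷_; map; filter; upTo)
open import Data.Product using (_,_)
open import Relation.Binary.PropositionalEquality as P using (_≡_; refl; cong; cong₂)
open import Relation.Binary.Bundles using (Setoid)
import Relation.Binary.Reasoning.Setoid as SetoidReasoning

-- Two coefficient lists denote the same polynomial iff all coefficients
-- agree (trailing zeros are irrelevant).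
record _≈_ (f g : Poly) : Set where
  constructor mk≈
  field at : ∀ i → coeff f i ≡ coeff g i
open _≈_
infix 4 _≈_

≈-refl : ∀ {f} → f ≈ f
≈-refl = mk≈ λ i → refl

≈-sym : ∀ {f g} → f ≈ g → g ≈ f
≈-sym e = mk≈ λ i → P.sym (at e i)

≈-trans : ∀ {f g k} → f ≈ g → g ≈ k → f ≈ k
≈-trans e e' = mk≈ λ i → P.trans (at e i) (at e' i)

≡⇒≈ : ∀ {f g} → f ≡ g → f ≈ g
≡⇒≈ refl = ≈-refl

∷-cong : ∀ {a b f g} → a ≡ b → f ≈ g → (a ∷ f) ≈ (b ∷ g)
∷-cong e e' = mk≈ λ { zero → e ; (suc i) → at e' i }

tail-≈ : ∀ {a b f g} → (a ∷ f) ≈ (b ∷ g) → f ≈ g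
tail-≈ e = mk≈ λ i → at e (suc i)

≈-setoid : Setoid _ _
≈-setoid = record
  { Carrier = Poly ; _≈_ = _≈_
  ; isEquivalence = record { refl = ≈-refl ; sym = ≈-sym ; trans = ≈-trans } }

module ≈-Reasoning = SetoidReasoning ≈-setoid

coeff-⊕ : ∀ f g i → coeff (f ⊕ g) i ≡ coeff f i Q.+ coeff g i
coeff-⊕ []      g       i       = P.sym (QP.+-identityˡ _)
coeff-⊕ (a ∷ f) []      i       = P.sym (QP.+-identityʳ _)
coeff-⊕ (a ∷ f) (b ∷ g) zero    = refl
coeff-⊕ (a ∷ f) (b ∷ g) (suc i) = coeff-⊕ f g i

coeff-scale : ∀ c f i → coeff (scale c f) i ≡ c Q.* coeff f i
coeff-scale c []      i       = P.sym (QP.*-zeroʳ c)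
coeff-scale c (a ∷ f) zero    = refl
coeff-scale c (a ∷ f) (suc i) = coeff-scale c f i

coeff-⊖ : ∀ f g i → coeff (f ⊖ g) i ≡ coeff f i Q.+ (Q.- 1ℚ) Q.* coeff g i
coeff-⊖ f g i = P.trans (coeff-⊕ f (scale (Q.- 1ℚ) g) i)
                        (cong (coeff f i Q.+_) (coeff-scale (Q.- 1ℚ) g i))

⊕-cong : ∀ {f f' g g'} → f ≈ f' → g ≈ g' → f ⊕ g ≈ f' ⊕ g'
⊕-cong {f} {f'} {g} {g'} e e' = mk≈ λ i → P.trans (coeff-⊕ f g i)
  (P.trans (cong₂ Q._+_ (at e i) (at e' i)) (P.sym (coeff-⊕ f' g' i)))

⊕-identityʳ : ∀ f → f ⊕ [] ≈ f
⊕-identityʳ f = mk≈ λ i → P.trans (coeff-⊕ f [] i) (QP.+-identityʳ (coeff f i))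

⊕-interchange : ∀ x y z w → (x ⊕ y) ⊕ (z ⊕ w) ≈ (x ⊕ z) ⊕ (y ⊕ w)
⊕-interchange x y z w = mk≈ λ i → let open P.≡-Reasoning in begin
  coeff ((x ⊕ y) ⊕ (z ⊕ w)) i
    ≡⟨ P.trans (coeff-⊕ (x ⊕ y) (z ⊕ w) i) (cong₂ Q._+_ (coeff-⊕ x y i) (coeff-⊕ z w i)) ⟩
  (coeff x i Q.+ coeff y i) Q.+ (coeff z i Q.+ coeff w i)
    ≡⟨ solve 4 (λ a b c d → (a :+ b) :+ (c :+ d) := (a :+ c) :+ (b :+ d)) refl
               (coeff x i) (coeff y i) (coeff z i) (coeff w i) ⟩
  (coeff x i Q.+ coeff z i) Q.+ (coeff y i Q.+ coeff w i)
    ≡⟨ P.sym (P.trans (coeff-⊕ (x ⊕ z) (y ⊕ w) i) (cong₂ Q._+_ (coeff-⊕ x z i) (coeff-⊕ y w i))) ⟩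
  coeff ((x ⊕ z) ⊕ (y ⊕ w)) i ∎

⊕-lcomm : ∀ x y z → x ⊕ (y ⊕ z) ≈ y ⊕ (x ⊕ z)
⊕-lcomm x y z = mk≈ λ i → P.trans (coeff-⊕ x (y ⊕ z) i)
  (P.trans (cong (coeff x i Q.+_) (coeff-⊕ y z i))
  (P.trans (solve 3 (λ a b c → a :+ (b :+ c) := b :+ (a :+ c)) refl (coeff x i) (coeff y i) (coeff z i))
  (P.sym (P.trans (coeff-⊕ y (x ⊕ z) i) (cong (coeff y i Q.+_) (coeff-⊕ x z i))))))

scale-cong : ∀ c {f f'} → f ≈ f' → scale c f ≈ scale c f'
scale-cong c {f} {f'} e = mk≈ λ i → P.trans (coeff-scale c f i)
  (P.trans (cong (c Q.*_) (at e i)) (P.sym (coeff-scale c f' i)))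

scale-zero : ∀ g → scale 0ℚ g ≈ []
scale-zero g = mk≈ λ i → P.trans (coeff-scale 0ℚ g i) (QP.*-zeroˡ (coeff g i))

scale-one : ∀ g → scale 1ℚ g ≈ g
scale-one g = mk≈ λ i → P.trans (coeff-scale 1ℚ g i) (QP.*-identityˡ (coeff g i))

scale-distrib : ∀ a b g → scale (a Q.+ b) g ≈ scale a g ⊕ scale b g
scale-distrib a b g = mk≈ λ i → P.trans (coeff-scale (a Q.+ b) g i)
  (P.trans (QP.*-distribʳ-+ (coeff g i) a b)
  (P.sym (P.trans (coeff-⊕ (scale a g) (scale b g) i) (cong₂ Q._+_ (coeff-scale a g i) (coeff-scale b g i)))))

scale-⊕ : ∀ c f g → scale c (f ⊕ g) ≈ scale c f ⊕ scale c g
scale-⊕ c f g = mk≈ λ i → P.trans (coeff-scale c (f ⊕ g) i)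
  (P.trans (cong (c Q.*_) (coeff-⊕ f g i))
  (P.trans (QP.*-distribˡ-+ c (coeff f i) (coeff g i))
  (P.sym (P.trans (coeff-⊕ (scale c f) (scale c g) i) (cong₂ Q._+_ (coeff-scale c f i) (coeff-scale c g i))))))

scale-scale : ∀ c a g → scale c (scale a g) ≈ scale (c Q.* a) g
scale-scale c a g = mk≈ λ i → P.trans (coeff-scale c (scale a g) i)
  (P.trans (cong (c Q.*_) (coeff-scale a g i))
  (P.trans (P.sym (QP.*-assoc c a (coeff g i))) (P.sym (coeff-scale (c Q.* a) g i))))

const0 : const 0ℚ ≈ []
const0 = mk≈ λ { zero → refl ; (suc i) → refl }

-- Multiplication.  `f ⊗ g` recurses on f; the laws are proved by
-- induction on the left factor, and commutativity transports them to
-- the right.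
⊗-zeroˡ : ∀ f g → f ≈ [] → f ⊗ g ≈ []
⊗-zeroˡ []      g e = ≈-refl
⊗-zeroˡ (a ∷ f) g e =
  ≈-trans (⊕-cong (≈-trans (≡⇒≈ (cong (λ c → scale c g) (at e zero))) (scale-zero g))
                  (∷-cong refl (⊗-zeroˡ f g (mk≈ λ i → at e (suc i)))))
          const0

⊗-zeroʳ : ∀ f → f ⊗ [] ≈ []
⊗-zeroʳ []      = ≈-refl
⊗-zeroʳ (a ∷ f) = mk≈ λ { zero → refl ; (suc i) → at (⊗-zeroʳ f) i }

⊗-congˡ : ∀ {f f'} g → f ≈ f' → f ⊗ g ≈ f' ⊗ g
⊗-congˡ {[]}    {[]}     g e = ≈-refl
⊗-congˡ {[]}    {b ∷ f'} g e = ≈-sym (⊗-zeroˡ (b ∷ f') g (≈-sym e))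
⊗-congˡ {a ∷ f} {[]}     g e = ⊗-zeroˡ (a ∷ f) g e
⊗-congˡ {a ∷ f} {b ∷ f'} g e =
  ⊕-cong (≡⇒≈ (cong (λ c → scale c g) (at e zero))) (∷-cong refl (⊗-congˡ g (tail-≈ e)))

⊗-congʳ : ∀ f {g g'} → g ≈ g' → f ⊗ g ≈ f ⊗ g'
⊗-congʳ []      e = ≈-refl
⊗-congʳ (a ∷ f) e = ⊕-cong (scale-cong a e) (∷-cong refl (⊗-congʳ f e))

⊗-consʳ : ∀ f b g → f ⊗ (b ∷ g) ≈ scale b f ⊕ (0ℚ ∷ (f ⊗ g))
⊗-consʳ []      b g = mk≈ λ { zero → refl ; (suc i) → refl }
⊗-consʳ (a ∷ f) b g = mk≈ λ
  { zero    → cong (Q._+ 0ℚ) (QP.*-comm a b)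
  ; (suc i) → at (≈-trans (⊕-cong (≈-refl {scale a g}) (⊗-consʳ f b g))
                          (⊕-lcomm (scale a g) (scale b f) (0ℚ ∷ (f ⊗ g)))) i }

⊗-comm : ∀ f g → f ⊗ g ≈ g ⊗ f
⊗-comm []      g = ≈-sym (⊗-zeroʳ g)
⊗-comm (a ∷ f) g =
  ≈-trans (⊕-cong (≈-refl {scale a g}) (∷-cong refl (⊗-comm f g))) (≈-sym (⊗-consʳ g a f))

⊗-distribʳ : ∀ f f' g → (f ⊕ f') ⊗ g ≈ f ⊗ g ⊕ f' ⊗ g
⊗-distribʳ []      f'       g = ≈-refl
⊗-distribʳ (a ∷ f) []       g = ≈-sym (⊕-identityʳ _)
⊗-distribʳ (a ∷ f) (b ∷ f') g =
  ≈-trans (⊕-cong (scale-distrib a b g) (∷-cong (P.sym (QP.+-identityʳ 0ℚ)) (⊗-distribʳ f f' g)))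
          (⊕-interchange (scale a g) (scale b g) (0ℚ ∷ (f ⊗ g)) (0ℚ ∷ (f' ⊗ g)))

⊗-distribˡ : ∀ f g k → f ⊗ (g ⊕ k) ≈ f ⊗ g ⊕ f ⊗ k
⊗-distribˡ f g k = ≈-trans (⊗-comm f (g ⊕ k))
  (≈-trans (⊗-distribʳ g k f) (⊕-cong (⊗-comm g f) (⊗-comm k f)))

⊗-scaleˡ : ∀ c f g → scale c f ⊗ g ≈ scale c (f ⊗ g)
⊗-scaleˡ c []      g = ≈-refl
⊗-scaleˡ c (a ∷ f) g =
  ≈-trans (⊕-cong (≈-sym (scale-scale c a g)) (∷-cong (P.sym (QP.*-zeroʳ c)) (⊗-scaleˡ c f g)))
          (≈-sym (scale-⊕ c (scale a g) (0ℚ ∷ (f ⊗ g))))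

⊗-scaleʳ : ∀ c f g → f ⊗ scale c g ≈ scale c (f ⊗ g)
⊗-scaleʳ c f g = ≈-trans (⊗-comm f (scale c g)) (≈-trans (⊗-scaleˡ c g f) (scale-cong c (⊗-comm g f)))

shift-⊗ : ∀ f g → (0ℚ ∷ f) ⊗ g ≈ 0ℚ ∷ (f ⊗ g)
shift-⊗ f g = ⊕-cong (scale-zero g) ≈-refl

⊗-assoc : ∀ f g k → (f ⊗ g) ⊗ k ≈ f ⊗ (g ⊗ k)
⊗-assoc []      g k = ≈-refl
⊗-assoc (a ∷ f) g k =
  ≈-trans (⊗-distribʳ (scale a g) (0ℚ ∷ (f ⊗ g)) k)
          (⊕-cong (⊗-scaleˡ a g k) (≈-trans (shift-⊗ (f ⊗ g) k) (∷-cong refl (⊗-assoc f g k))))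

const⊗ : ∀ a g → const a ⊗ g ≈ scale a g
const⊗ a g = ≈-trans (⊕-cong ≈-refl const0) (⊕-identityʳ _)

one⊗ : ∀ g → onePoly ⊗ g ≈ g
one⊗ g = ≈-trans (const⊗ 1ℚ g) (scale-one g)

tpow-cong : ∀ {a b} → a ≡ b → tpow a ≈ tpow b
tpow-cong refl = ≈-refl

tpow-+ : ∀ a b → tpow (a + b) ≈ tpow a ⊗ tpow b
tpow-+ zero    b = ≈-sym (one⊗ (tpow b))
tpow-+ (suc a) b = ≈-sym (≈-trans (shift-⊗ (tpow a) (tpow b)) (∷-cong refl (≈-sym (tpow-+ a b))))

pow-tpow : ∀ a r → pow (tpow a) r ≈ tpow (a * r)
pow-tpow a zero    = tpow-cong (P.sym (ℕP.*-zeroʳ a))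
pow-tpow a (suc r) = ≈-trans (⊗-congʳ (tpow a) (pow-tpow a r))
  (≈-trans (≈-sym (tpow-+ a (a * r))) (tpow-cong (P.sym (ℕP.*-suc a r))))

compose-⊕ : ∀ f g s → compose (f ⊕ g) s ≈ compose f s ⊕ compose g s
compose-⊕ []      g       s = ≈-refl
compose-⊕ (a ∷ f) []      s = ≈-sym (⊕-identityʳ _)
compose-⊕ (a ∷ f) (b ∷ g) s =
  ≈-trans (⊕-cong (≈-refl {const (a Q.+ b)})
            (≈-trans (⊗-congʳ s (compose-⊕ f g s)) (⊗-distribˡ s (compose f s) (compose g s))))
          (⊕-interchange (const a) (const b) (s ⊗ compose f s) (s ⊗ compose g s))

compose-scale : ∀ c f s → compose (scale c f) s ≈ scale c (compose f s)
compose-scale c []      s = ≈-refl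
compose-scale c (a ∷ f) s =
  ≈-trans (⊕-cong (≈-refl {const (c Q.* a)})
            (≈-trans (⊗-congʳ s (compose-scale c f s)) (⊗-scaleʳ c s (compose f s))))
          (≈-sym (scale-⊕ c (const a) (s ⊗ compose f s)))

compose-const : ∀ c s → compose (const c) s ≈ const c
compose-const c s = ≈-trans (⊕-cong ≈-refl (⊗-zeroʳ s)) (⊕-identityʳ _)

compose-⊗ : ∀ f g s → compose (f ⊗ g) s ≈ compose f s ⊗ compose g s
compose-⊗ []      g s = ≈-refl
compose-⊗ (a ∷ f) g s = begin
  compose (scale a g ⊕ (0ℚ ∷ (f ⊗ g))) s
    ≈⟨ compose-⊕ (scale a g) (0ℚ ∷ (f ⊗ g)) s ⟩
  compose (scale a g) s ⊕ (const 0ℚ ⊕ s ⊗ compose (f ⊗ g) s)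
    ≈⟨ ⊕-cong (compose-scale a g s) (⊕-cong const0 (⊗-congʳ s (compose-⊗ f g s))) ⟩
  scale a (compose g s) ⊕ s ⊗ (compose f s ⊗ compose g s)
    ≈⟨ ⊕-cong (≈-sym (const⊗ a (compose g s))) (≈-sym (⊗-assoc s (compose f s) (compose g s))) ⟩
  const a ⊗ compose g s ⊕ (s ⊗ compose f s) ⊗ compose g s
    ≈⟨ ≈-sym (⊗-distribʳ (const a) (s ⊗ compose f s) (compose g s)) ⟩
  compose (a ∷ f) s ⊗ compose g s ∎
  where open ≈-Reasoning

compose-pow : ∀ f e s → compose (pow f e) s ≈ pow (compose f s) e
compose-pow f zero    s = compose-const 1ℚ s
compose-pow f (suc e) s =
  ≈-trans (compose-⊗ f (pow f e) s) (⊗-congʳ (compose f s) (compose-pow f e s))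

compose-tpow : ∀ a s → compose (tpow a) s ≈ pow s a
compose-tpow zero    s = compose-const 1ℚ s
compose-tpow (suc a) s = ≈-trans (⊕-cong const0 (⊗-congʳ s (compose-tpow a s))) ≈-refl

polySum-map-cong : (R : Poly → Poly → Set) →
  (∀ {f f' g g'} → R f f' → R g g' → R (f ⊕ g) (f' ⊕ g')) → R [] [] →
  ∀ (F G : ℕ → Poly) L → (∀ k → R (F k) (G k)) → R (polySum (map F L)) (polySum (map G L))
polySum-map-cong R ⊕-resp []-resp F G []      e = []-resp
polySum-map-cong R ⊕-resp []-resp F G (k ∷ L) e = ⊕-resp (e k) (polySum-map-cong R ⊕-resp []-resp F G L e)

compose-polySum : ∀ (F : ℕ → Poly) L s →
  compose (polySum (map F L)) s ≈ polySum (map (λ k → compose (F k) s) L)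
compose-polySum F []      s = ≈-refl
compose-polySum F (k ∷ L) s =
  ≈-trans (compose-⊕ (F k) (polySum (map F L)) s) (⊕-cong ≈-refl (compose-polySum F L s))

divisorsOf : ℕ → List ℕ
divisorsOf m = filter (λ k → suc k ∣? m) (upTo m)

cycleIndexTerm : ℕ → (ℕ → Poly) → ℕ → Poly
cycleIndexTerm m z k = scale (ℕ→ℚ (φ (suc k))) (pow (z (suc k)) (m / suc k))

compose-cycleIndex : ∀ m z s → compose (cycleIndex m z) s ≈ cycleIndex m (λ r → compose (z r) s)
compose-cycleIndex zero    z s = ≈-refl
compose-cycleIndex m@(suc n) z s =
  ≈-trans (compose-scale (ℤ.+ 1 Q./ m) (polySum (map (cycleIndexTerm m z) (divisorsOf m))) s)
  (scale-cong (ℤ.+ 1 Q./ m)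
    (≈-trans (compose-polySum (cycleIndexTerm m z) (divisorsOf m) s)
      (polySum-map-cong _≈_ ⊕-cong ≈-refl _ _ (divisorsOf m) λ k →
        ≈-trans (compose-scale (ℕ→ℚ (φ (suc k))) (pow (z (suc k)) (m / suc k)) s)
                (scale-cong (ℕ→ℚ (φ (suc k))) (compose-pow (z (suc k)) (m / suc k) s)))))

module Congruence (h : Poly) where

  record _∼_ (f g : Poly) : Set where
    constructor mk∼
    field
      quotient : Poly
      witness  : f ⊖ g ≈ quotient ⊗ h
  infix 4 _∼_

  ∼⇒mod : ∀ {f g} → f ∼ g → f ≡ g [mod h ]
  ∼⇒mod (mk∼ q e) = q , at e

  ≈⇒∼ : ∀ {f g} → f ≈ g → f ∼ g
  ≈⇒∼ {f} {g} e = mk∼ [] (mk≈ λ i → P.trans (coeff-⊖ f g i)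
    (P.trans (cong (λ y → coeff f i Q.+ (Q.- 1ℚ) Q.* y) (P.sym (at e i)))
             (solve 1 (λ x → x :+ con (Q.- 1ℚ) :* x := con 0ℚ) refl (coeff f i))))

  ∼-refl : ∀ {f} → f ∼ f
  ∼-refl = ≈⇒∼ ≈-refl

  ∼-sym : ∀ {f g} → f ∼ g → g ∼ f
  ∼-sym {f} {g} (mk∼ q e) = mk∼ (scale (Q.- 1ℚ) q)
    (≈-trans negate (≈-trans (scale-cong (Q.- 1ℚ) e) (≈-sym (⊗-scaleˡ (Q.- 1ℚ) q h))))
    where
    negate : g ⊖ f ≈ scale (Q.- 1ℚ) (f ⊖ g)
    negate = mk≈ λ i → P.trans (coeff-⊖ g f i) (P.sym (P.trans (coeff-scale (Q.- 1ℚ) (f ⊖ g) i)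
      (P.trans (cong ((Q.- 1ℚ) Q.*_) (coeff-⊖ f g i))
        (solve 2 (λ x y → con (Q.- 1ℚ) :* (x :+ con (Q.- 1ℚ) :* y) := y :+ con (Q.- 1ℚ) :* x)
               refl (coeff f i) (coeff g i)))))

  ∼-trans : ∀ {f g k} → f ∼ g → g ∼ k → f ∼ k
  ∼-trans {f} {g} {k} (mk∼ q₁ e₁) (mk∼ q₂ e₂) = mk∼ (q₁ ⊕ q₂)
    (≈-trans telescope (≈-trans (⊕-cong e₁ e₂) (≈-sym (⊗-distribʳ q₁ q₂ h))))
    where
    telescope : f ⊖ k ≈ (f ⊖ g) ⊕ (g ⊖ k)
    telescope = mk≈ λ i → P.trans (coeff-⊖ f k i) (P.sym (P.trans (coeff-⊕ (f ⊖ g) (g ⊖ k) i)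
      (P.trans (cong₂ Q._+_ (coeff-⊖ f g i) (coeff-⊖ g k i))
        (solve 3 (λ x y z → (x :+ con (Q.- 1ℚ) :* y) :+ (y :+ con (Q.- 1ℚ) :* z) := x :+ con (Q.- 1ℚ) :* z)
               refl (coeff f i) (coeff g i) (coeff k i)))))

  ∼-setoid : Setoid _ _
  ∼-setoid = record
    { Carrier = Poly ; _≈_ = _∼_
    ; isEquivalence = record { refl = ∼-refl ; sym = ∼-sym ; trans = ∼-trans } }

  module ∼-Reasoning = SetoidReasoning ∼-setoid

  ⊕-cong∼ : ∀ {f f' g g'} → f ∼ g → f' ∼ g' → f ⊕ f' ∼ g ⊕ g'
  ⊕-cong∼ {f} {f'} {g} {g'} (mk∼ q₁ e₁) (mk∼ q₂ e₂) = mk∼ (q₁ ⊕ q₂)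
    (≈-trans regroup (≈-trans (⊕-cong e₁ e₂) (≈-sym (⊗-distribʳ q₁ q₂ h))))
    where
    regroup : (f ⊕ f') ⊖ (g ⊕ g') ≈ (f ⊖ g) ⊕ (f' ⊖ g')
    regroup = mk≈ λ i → P.trans (coeff-⊖ (f ⊕ f') (g ⊕ g') i)
      (P.trans (cong₂ (λ u v → u Q.+ (Q.- 1ℚ) Q.* v) (coeff-⊕ f f' i) (coeff-⊕ g g' i))
      (P.sym (P.trans (coeff-⊕ (f ⊖ g) (f' ⊖ g') i)
      (P.trans (cong₂ Q._+_ (coeff-⊖ f g i) (coeff-⊖ f' g' i))
        (solve 4 (λ x x' y y' → (x :+ con (Q.- 1ℚ) :* y) :+ (x' :+ con (Q.- 1ℚ) :* y')
                              := (x :+ x') :+ con (Q.- 1ℚ) :* (y :+ y'))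
               refl (coeff f i) (coeff f' i) (coeff g i) (coeff g' i))))))

  scale-cong∼ : ∀ c {f g} → f ∼ g → scale c f ∼ scale c g
  scale-cong∼ c {f} {g} (mk∼ q e) = mk∼ (scale c q)
    (≈-trans factor (≈-trans (scale-cong c e) (≈-sym (⊗-scaleˡ c q h))))
    where
    factor : scale c f ⊖ scale c g ≈ scale c (f ⊖ g)
    factor = mk≈ λ i → P.trans (coeff-⊖ (scale c f) (scale c g) i)
      (P.trans (cong₂ (λ u v → u Q.+ (Q.- 1ℚ) Q.* v) (coeff-scale c f i) (coeff-scale c g i))
      (P.sym (P.trans (coeff-scale c (f ⊖ g) i) (P.trans (cong (c Q.*_) (coeff-⊖ f g i))
        (solve 3 (λ k x y → k :* (x :+ con (Q.- 1ℚ) :* y) := k :* x :+ con (Q.- 1ℚ) :* (k :* y))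
               refl c (coeff f i) (coeff g i))))))

  ⊗-congˡ∼ : ∀ {f g} k → f ∼ g → f ⊗ k ∼ g ⊗ k
  ⊗-congˡ∼ {f} {g} k (mk∼ q e) = mk∼ (q ⊗ k) (begin
    f ⊗ k ⊖ g ⊗ k                     ≈⟨ ⊕-cong (≈-refl {f ⊗ k}) (≈-sym (⊗-scaleˡ (Q.- 1ℚ) g k)) ⟩
    f ⊗ k ⊕ scale (Q.- 1ℚ) g ⊗ k      ≈⟨ ≈-sym (⊗-distribʳ f (scale (Q.- 1ℚ) g) k) ⟩
    (f ⊖ g) ⊗ k                       ≈⟨ ⊗-congˡ k e ⟩
    (q ⊗ h) ⊗ k                       ≈⟨ ⊗-assoc q h k ⟩
    q ⊗ (h ⊗ k)                       ≈⟨ ⊗-congʳ q (⊗-comm h k) ⟩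
    q ⊗ (k ⊗ h)                       ≈⟨ ≈-sym (⊗-assoc q k h) ⟩
    (q ⊗ k) ⊗ h                       ∎)
    where open ≈-Reasoning

  ⊗-cong∼ : ∀ {f f' g g'} → f ∼ g → f' ∼ g' → f ⊗ f' ∼ g ⊗ g'
  ⊗-cong∼ {f} {f'} {g} {g'} e e' = begin
    f ⊗ f'  ≈⟨ ⊗-congˡ∼ f' e ⟩
    g ⊗ f'  ≈⟨ ≈⇒∼ (⊗-comm g f') ⟩
    f' ⊗ g  ≈⟨ ⊗-congˡ∼ g e' ⟩
    g' ⊗ g  ≈⟨ ≈⇒∼ (⊗-comm g' g) ⟩
    g ⊗ g'  ∎
    where open ∼-Reasoning

  pow-cong∼ : ∀ {f g} n → f ∼ g → pow f n ∼ pow g n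
  pow-cong∼ zero    e = ∼-refl
  pow-cong∼ (suc n) e = ⊗-cong∼ e (pow-cong∼ n e)

  cycleIndex-cong∼ : ∀ m {z z' : ℕ → Poly} → (∀ r → z r ∼ z' r) → cycleIndex m z ∼ cycleIndex m z'
  cycleIndex-cong∼ zero      e = ∼-refl
  cycleIndex-cong∼ m@(suc n) {z} {z'} e = scale-cong∼ (ℤ.+ 1 Q./ m)
    (polySum-map-cong _∼_ ⊕-cong∼ ∼-refl (cycleIndexTerm m z) (cycleIndexTerm m z') (divisorsOf m)
      λ k → scale-cong∼ (ℕ→ℚ (φ (suc k))) (pow-cong∼ (m / suc k) (e (suc k))))

module Swap (h s : Poly) (z w : ℕ → Poly) where
  open Congruence h

  module _ (z↦w : ∀ r → compose (z r) s ∼ w r) (w↦z : ∀ r → compose (w r) s ∼ z r) (m : ℕ) where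

    substituted-cycleIndex : ∀ {u v} → (∀ r → compose (u r) s ∼ v r) →
      compose (cycleIndex m u) s ∼ cycleIndex m v
    substituted-cycleIndex u↦v = ∼-trans (≈⇒∼ (compose-cycleIndex m _ s)) (cycleIndex-cong∼ m u↦v)

    product-invariant : cycleIndex m z ⊗ cycleIndex m w ∼ compose (cycleIndex m z ⊗ cycleIndex m w) s
    product-invariant = ∼-sym (begin
      compose (cycleIndex m z ⊗ cycleIndex m w) s
        ≈⟨ ≈⇒∼ (compose-⊗ (cycleIndex m z) (cycleIndex m w) s) ⟩
      compose (cycleIndex m z) s ⊗ compose (cycleIndex m w) s
        ≈⟨ ⊗-cong∼ (substituted-cycleIndex z↦w) (substituted-cycleIndex w↦z) ⟩
      cycleIndex m w ⊗ cycleIndex m z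
        ≈⟨ ≈⇒∼ (⊗-comm (cycleIndex m w) (cycleIndex m z)) ⟩
      cycleIndex m z ⊗ cycleIndex m w ∎)
      where open ∼-Reasoning

    zw↦zw : ∀ r → compose (z r ⊗ w r) s ∼ z r ⊗ w r
    zw↦zw r = ∼-trans (≈⇒∼ (compose-⊗ (z r) (w r) s))
      (∼-trans (⊗-cong∼ (z↦w r) (w↦z r)) (≈⇒∼ (⊗-comm (w r) (z r))))

    diagonal-invariant : cycleIndex m (λ r → z r ⊗ w r) ∼ compose (cycleIndex m (λ r → z r ⊗ w r)) s
    diagonal-invariant = ∼-sym (substituted-cycleIndex zw↦zw)

module Frobenius (p N : ℕ) (p²≡1+N : p * p ≡ suc N) where
  open Congruence (tpow N ⊖ onePoly)

  t^N∼1 : tpow N ∼ onePoly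
  t^N∼1 = mk∼ onePoly (≈-sym (one⊗ (tpow N ⊖ onePoly)))

  t^p²∼t : tpow (p * p) ∼ tpow 1
  t^p²∼t = begin
    tpow (p * p)           ≈⟨ ≈⇒∼ (tpow-cong p²≡1+N) ⟩
    tpow (1 + N)           ≈⟨ ≈⇒∼ (tpow-+ 1 N) ⟩
    tpow 1 ⊗ tpow N        ≈⟨ ⊗-cong∼ (∼-refl {tpow 1}) t^N∼1 ⟩
    tpow 1 ⊗ onePoly       ≈⟨ ≈⇒∼ (≈-trans (⊗-comm (tpow 1) onePoly) (one⊗ (tpow 1))) ⟩
    tpow 1                 ∎
    where open ∼-Reasoning

  t^p²r∼t^r : ∀ r → tpow (p * (p * r)) ∼ tpow r
  t^p²r∼t^r r = begin
    tpow (p * (p * r))     ≈⟨ ≈⇒∼ (tpow-cong (P.sym (ℕP.*-assoc p p r))) ⟩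
    tpow (p * p * r)       ≈⟨ ≈⇒∼ (≈-sym (pow-tpow (p * p) r)) ⟩
    pow (tpow (p * p)) r   ≈⟨ pow-cong∼ r t^p²∼t ⟩
    pow (tpow 1) r         ≈⟨ ≈⇒∼ (≈-trans (pow-tpow 1 r) (tpow-cong (ℕP.*-identityˡ r))) ⟩
    tpow r                 ∎
    where open ∼-Reasoning

  substitute-1+t^a : ∀ a → compose (onePoly ⊕ tpow a) (tpow p) ≈ onePoly ⊕ tpow (p * a)
  substitute-1+t^a a = ≈-trans (compose-⊕ onePoly (tpow a) (tpow p))
    (⊕-cong (compose-const 1ℚ (tpow p)) (≈-trans (compose-tpow a (tpow p)) (pow-tpow p a)))

  x↦y : ∀ r → compose (xs p r) (tpow p) ∼ ys p r
  x↦y r = ≈⇒∼ (substitute-1+t^a r)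

  y↦x : ∀ r → compose (ys p r) (tpow p) ∼ xs p r
  y↦x r = ∼-trans (≈⇒∼ (substitute-1+t^a (p * r))) (⊕-cong∼ (∼-refl {onePoly}) (t^p²r∼t^r r))

  open Swap (tpow N ⊖ onePoly) (tpow p) (xs p) (ys p)

  A₁-invariant : ∀ m → (cycleIndex m (xs p) ⊗ cycleIndex m (ys p))
                     ≡ compose (cycleIndex m (xs p) ⊗ cycleIndex m (ys p)) (tpow p) [mod tpow N ⊖ onePoly ]
  A₁-invariant m = ∼⇒mod (product-invariant x↦y y↦x m)

  A₂₂-invariant : ∀ m → cycleIndex m (λ r → xs p r ⊗ ys p r)
                      ≡ compose (cycleIndex m (λ r → xs p r ⊗ ys p r)) (tpow p) [mod tpow N ⊖ onePoly ]
  A₂₂-invariant m = ∼⇒mod (diagonal-invariant x↦y y↦x m)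

-- The theorem.  A prime p is nonzero, so p = n + 1 and p² = (p² - 1) + 1
-- holds definitionally.

proposition2 : (p : ℕ) → Prime p → p ≢ 2 →
    (A₁ p ≡ compose (A₁ p) (tpow p) [mod (tpow (p * p ∸ 1) ⊖ onePoly) ])
    × (A₂₂ p ≡ compose (A₂₂ p) (tpow p) [mod (tpow (p * p ∸ 1) ⊖ onePoly) ])
proposition2 zero    (prime {{()}} _) _
proposition2 (suc n) _ _ = A₁-invariant n , A₂₂-invariant n
  where open Frobenius (suc n) (suc n * suc n ∸ 1) refl
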